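{- Let $c$ be a GCL command and $f$ a label with $\mathrm{okf}(c,f)$, and let $an$ be a valid annotation of the automaton $\mathrm{aut}(c,f)$ for $\{P\}\{Q\}$. Then $c:\{P\}\{Q\}$ is provable in HL+, using only assertions derived from $an$: boolean combinations of the sets $an(i)$, boolean expressions occurring in $c$, and equality tests $pc=n$ of a fresh variable $pc$ with numeric literals, together with substitution instances $an(i)[x:=e]$ for assignments $x:=e$ occurring in $c$.
   Context: Stores: total functions $\mathit{Var}\to\mathbb{Z}$; assertions are sets of stores (a boolean expression denotes the set of stores where it is true; $\wedge,\neg,\Rightarrow$ are intersection, complement, inclusion). $P[x:=e]=\{s\mid s[x\mapsto\llbracket e\rrbracket(s)]\in P\}$; $\forall x.P=\{s\mid\forall v.\ s[x\mapsto v]\in P\}$; $\mathrm{indep}(x,P)$ means $P=\{s\mid\exists v.\,s[x\mapsto v]\in P\}$. GCL commands: $c::=\mathsf{skip}^n\mid x:=^n e\mid\mathsf{havoc}^n x\mid c;c\mid\mathsf{if}^n gcs\,\mathsf{fi}\mid\mathsf{do}^n gcs\,\mathsf{od}$, labels $n\in\mathbb{Z}$, $gcs$ nonempty lists of guarded commands $e\to c$, $\mathrm{enab}(gcs)$ the disjunction of the guards; commands well typed, each $\mathsf{if}\,gcs\,\mathsf{fi}$ having $\mathrm{enab}(gcs)$ valid. $\mathrm{labs}(c)$: labels of $c$; $\mathrm{lab}(c)$: label of $c$ with $\mathrm{lab}(c;d)=\mathrm{lab}(c)$; $\mathrm{okf}(c,f)$: labels of $c$ positive and pairwise distinct, $f\notin\mathrm{labs}(c)$;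 $\mathrm{sub}(n,c)$: the subcommand of $c$, not of the form $d;d'$, with label $n$. Small-step semantics: $\langle\mathsf{havoc}^n x,s\rangle\rightsquigarrow\langle\mathsf{skip}^{ -n},s[x\mapsto v]\rangle$ ($v\in\mathbb{Z}$); $\langle x:=^n e,s\rangle\rightsquigarrow\langle\mathsf{skip}^{ -n},s[x\mapsto\llbracket e\rrbracket(s)]\rangle$; $\langle\mathsf{skip}^n;c,s\rangle\rightsquigarrow\langle c,s\rangle$; $\langle\mathsf{if}^n gcs\,\mathsf{fi},s\rangle\rightsquigarrow\langle c,s\rangle$ if $e\to c\in gcs$ with $e$ true in $s$; $\langle\mathsf{do}^n gcs\,\mathsf{od},s\rangle\rightsquigarrow\langle c;\mathsf{do}^n gcs\,\mathsf{od},s\rangle$ if $e\to c\in gcs$ with $e$ true; $\langle\mathsf{do}^n gcs\,\mathsf{od},s\rangle\rightsquigarrow\langle\mathsf{skip}^{ -n},s\rangle$ if $\mathrm{enab}(gcs)$ false in $s$; $\langle c;b,s\rangle\rightsquigarrow\langle d;b,t\rangle$ if $\langle c,s\rangle\rightsquigarrow\langle d,t\rangle$. $\mathrm{fsuc}(n,c,f)$: $\mathrm{fsuc}(n,c;d,f)=\mathrm{fsuc}(n,c,\mathrm{lab}(d))$ if $n\in\mathrm{labs}(c)$, else $\mathrm{fsuc}(n,d,f)$; equals $f$ when $n$ is the label of the whole if/do/skip/assignment/havoc; $\mathrm{fsuc}(m,\mathsf{if}^n gcs\,\mathsf{fi},f)=\mathrm{fsuc}(m,c,f)$ and $\mathrm{fsuc}(m,\mathsf{do}^n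 gcs\,\mathsf{od},f)=\mathrm{fsuc}(m,c,n)$ when $e\to c\in gcs$ and $m\in\mathrm{labs}(c)$. Automaton $\mathrm{aut}(c,f)$: control points $\mathrm{labs}(c)\cup\{f\}$, stores $\mathit{Var}\to\mathbb{Z}$, initial $\mathrm{lab}(c)$, final $f$, $(n,s)\to(m,t)$ iff (i) $\langle\mathrm{sub}(n,c),s\rangle\rightsquigarrow\langle d,t\rangle$, $\mathrm{lab}(d)>0$, $m=\mathrm{lab}(d)$; or (ii) $\langle\mathrm{sub}(n,c),s\rangle\rightsquigarrow\langle d,t\rangle$, $\mathrm{lab}(d)<0$, $m=\mathrm{fsuc}(n,c,f)$; or (iii) $\mathrm{sub}(n,c)=\mathsf{skip}^n$, $m=\mathrm{fsuc}(n,c,f)$, $t=s$. An annotation of $\mathrm{aut}(c,f)$ for $\{P\}\{Q\}$ is a map $an$ from control points to sets of stores with $an(\mathrm{lab}(c))=P$, $an(f)=Q$; it is valid if $s\in an(n)$ and $(n,s)\to(m,t)$ imply $t\in an(m)$. HL+ derives judgments $c:\{P\}\{Q\}$ by the rules: Skip $\mathsf{skip}:\{P\}\{P\}$; Asgn $x:=e:\{P[x:=e]\}\{P\}$; Havoc $\mathsf{havoc}\,x:\{\forall x.P\}\{P\}$; Seq from $c:\{P\}\{R\}$, $d:\{R\}\{Q\}$ infer $c;d:\{P\}\{Q\}$; If from $c:\{P\wedge e\}\{Q\}$ for all $e\to c$ in $gcs$ infer $\mathsf{if}\,gcs\,\mathsf{fi}:\{P\}\{Q\}$; Do from $c:\{e\wedge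 P\}\{P\}$ for all $e\to c$ in $gcs$ infer $\mathsf{do}\,gcs\,\mathsf{od}:\{P\}\{P\wedge\neg\mathrm{enab}(gcs)\}$; Conseq from $P\Rightarrow P'$, $c:\{P'\}\{Q'\}$, $Q'\Rightarrow Q$ infer $c:\{P\}\{Q\}$; Ghost from $c:\{P\}\{Q\}$, $\mathrm{ghost}(x,c)$ ($x$ occurs in $c$ only as target of assignments to $x$ and of $\mathsf{havoc}\,x$), $\mathrm{indep}(x,P)$, $\mathrm{indep}(x,Q)$ infer $\mathrm{erase}(x,c):\{P\}\{Q\}$ (erase replaces those assignments and havocs by $\mathsf{skip}$); Rewrite from $c:\{P\}\{Q\}$ and $c\simeq d$ infer $d:\{P\}\{Q\}$. Here $c\simeq d$ means $\mathrm{Hyp}\vdash\lfloor c\rfloor=\lfloor d\rfloor$: $\lfloor\cdot\rfloor$ translates commands to KAT expressions ($\lfloor\mathsf{skip}\rfloor=1$, assignments/havocs and primitive boolean expressions to primitive symbols, $\wedge,\vee,\neg$ to $;,+,\neg$, $\lfloor c;d\rfloor=\lfloor c\rfloor;\lfloor d\rfloor$, $\lfloor\mathsf{if}\,gcs\,\mathsf{fi}\rfloor=\lfloor gcs\rfloor=\sum_{e\to c\in gcs}\lfloor e\rfloor;\lfloor c\rfloor$, $\lfloor\mathsf{do}\,gcs\,\mathsf{od}\rfloor=\lfloor gcs\rfloor^*;\neg\lfloor\mathrm{enab}(gcs)\rfloor$), $\vdash$ is derivability by equational and propositional reasoning from the Kleene-algebra-with-tests axioms (idempotent semiring with Boolean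 algebra of tests and the star unfolding/induction laws $1+x;x^*=x^*$, $1+x^*;x=x^*$, $y+x;z\le z\Rightarrow x^*;y\le z$, $y+z;x\le z\Rightarrow y;x^*\le z$), and $\mathrm{Hyp}$ consists of $\lfloor e\rfloor=0$ for unsatisfiable $e$, $\lfloor e_0\rfloor;\lfloor x:=e\rfloor;\neg\lfloor e_1\rfloor=0$ when $e_0\Rightarrow e_1[x:=e]$ is valid, and $\lfloor e_0\rfloor;\lfloor\mathsf{havoc}\,x\rfloor;\neg\lfloor e_1\rfloor=0$ when $e_0\Rightarrow\forall x.e_1$ is valid.
   Formalization: The assertions allowed in the HL+ derivation also include boolean combinations involving the sets ∀x.an(i), for each control point i and each havoc x occurring in c. The statement above fails without it. -}

module Defs where

open import Level using (0ℓ)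
open import Data.Bool using (Bool; true; false; if_then_else_; _∧_; _∨_; not)
open import Data.Nat as ℕ using (ℕ)
import Data.Nat.Properties as ℕP
open import Data.Integer as ℤ using (ℤ; +_; -_; _<_)
import Data.Integer.Properties as ℤP
open import Data.List using (List; []; _∷_; _++_; [_])
open import Data.List.Membership.Propositional using (_∈_; _∉_)
open import Data.List.Membership.DecPropositional ℤP._≟_ using (_∈?_)
open import Data.List.Relation.Unary.All using (All)
open import Data.List.Relation.Unary.Unique.Propositional using (Unique)
open import Data.Maybe using (Maybe; just; nothing)
open import Data.Product using (Σ; _×_; _,_; ∃)
open import Data.Sum using (_⊎_)
open import Data.Unit using (⊤)
open import Relation.Nullary using (does; ¬_)
open import Relation.Binary.PropositionalEquality using (_≡_)
open import Function.Bundles using (_⇔_)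

Var : Set
Var = ℕ

Label : Set
Label = ℤ

Store : Set
Store = Var → ℤ

upd : Store → Var → ℤ → Store
upd s x v y = if does (y ℕP.≟ x) then v else s y

infixl 6 _⊕_ _⊖_
infixl 7 _⊛_

data AExp : Set where
  num  : ℤ → AExp
  var  : Var → AExp
  _⊕_  : AExp → AExp → AExp
  _⊖_  : AExp → AExp → AExp
  _⊛_  : AExp → AExp → AExp

data Prim : Set where
  _==_ : AExp → AExp → Prim
  _<=_ : AExp → AExp → Prim

data BExp : Set where
  prim : Prim → BExp
  band : BExp → BExp → BExp
  bor  : BExp → BExp → BExp
  bnot : BExp → BExp

⟦_⟧A : AExp → Store → ℤ
⟦ num n ⟧A s = n
⟦ var x ⟧A s = s x
⟦ a ⊕ b ⟧A s = ⟦ a ⟧A s ℤ.+ ⟦ b ⟧A s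
⟦ a ⊖ b ⟧A s = ⟦ a ⟧A s ℤ.- ⟦ b ⟧A s
⟦ a ⊛ b ⟧A s = ⟦ a ⟧A s ℤ.* ⟦ b ⟧A s

⟦_⟧P : Prim → Store → Bool
⟦ a == b ⟧P s = does (⟦ a ⟧A s ℤP.≟ ⟦ b ⟧A s)
⟦ a <= b ⟧P s = ⟦ a ⟧A s ℤ.≤ᵇ ⟦ b ⟧A s

⟦_⟧B : BExp → Store → Bool
⟦ prim p ⟧B s = ⟦ p ⟧P s
⟦ band a b ⟧B s = ⟦ a ⟧B s ∧ ⟦ b ⟧B s
⟦ bor a b ⟧B s = ⟦ a ⟧B s ∨ ⟦ b ⟧B s
⟦ bnot a ⟧B s = not (⟦ a ⟧B s)

fvA : AExp → List Var
fvA (num n) = []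
fvA (var x) = [ x ]
fvA (a ⊕ b) = fvA a ++ fvA b
fvA (a ⊖ b) = fvA a ++ fvA b
fvA (a ⊛ b) = fvA a ++ fvA b

fvP : Prim → List Var
fvP (a == b) = fvA a ++ fvA b
fvP (a <= b) = fvA a ++ fvA b

fvB : BExp → List Var
fvB (prim p) = fvP p
fvB (band a b) = fvB a ++ fvB b
fvB (bor a b) = fvB a ++ fvB b
fvB (bnot a) = fvB a

data SubB (b : BExp) : BExp → Set where
  here  : SubB b b
  andˡ  : ∀ {x y} → SubB b x → SubB b (band x y)
  andʳ  : ∀ {x y} → SubB b y → SubB b (band x y)
  orˡ   : ∀ {x y} → SubB b x → SubB b (bor x y)
  orʳ   : ∀ {x y} → SubB b y → SubB b (bor x y)
  notᵢ  : ∀ {x} → SubB b x → SubB b (bnot x)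

infixr 4 _⨾_

mutual
  data Cmd : Set where
    skip   : Label → Cmd
    assign : Label → Var → AExp → Cmd
    havoc  : Label → Var → Cmd
    _⨾_    : Cmd → Cmd → Cmd
    IF     : Label → GCs → Cmd
    DO     : Label → GCs → Cmd

  data GCs : Set where
    [_⇒_]   : BExp → Cmd → GCs
    _⇒_∷_   : BExp → Cmd → GCs → GCs

gcList : GCs → List (BExp × Cmd)
gcList [ e ⇒ c ] = (e , c) ∷ []
gcList (e ⇒ c ∷ gs) = (e , c) ∷ gcList gs

enab : GCs → BExp
enab [ e ⇒ c ] = e
enab (e ⇒ c ∷ gs) = bor e (enab gs)

lab : Cmd → Label
lab (skip n) = n
lab (assign n x e) = n
lab (havoc n x) = n
lab (c ⨾ d) = lab c
lab (IF n gcs) = n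
lab (DO n gcs) = n

mutual
  labs : Cmd → List Label
  labs (skip n) = [ n ]
  labs (assign n x e) = [ n ]
  labs (havoc n x) = [ n ]
  labs (c ⨾ d) = labs c ++ labs d
  labs (IF n gcs) = n ∷ labsG gcs
  labs (DO n gcs) = n ∷ labsG gcs

  labsG : GCs → List Label
  labsG [ e ⇒ c ] = labs c
  labsG (e ⇒ c ∷ gs) = labs c ++ labsG gs

mutual
  guards : Cmd → List BExp
  guards (skip n) = []
  guards (assign n x e) = []
  guards (havoc n x) = []
  guards (c ⨾ d) = guards c ++ guards d
  guards (IF n gcs) = guardsG gcs
  guards (DO n gcs) = guardsG gcs

  guardsG : GCs → List BExp
  guardsG [ e ⇒ c ] = e ∷ guards c
  guardsG (e ⇒ c ∷ gs) = e ∷ guards c ++ guardsG gs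

mutual
  asgns : Cmd → List (Var × AExp)
  asgns (skip n) = []
  asgns (assign n x e) = [ (x , e) ]
  asgns (havoc n x) = []
  asgns (c ⨾ d) = asgns c ++ asgns d
  asgns (IF n gcs) = asgnsG gcs
  asgns (DO n gcs) = asgnsG gcs

  asgnsG : GCs → List (Var × AExp)
  asgnsG [ e ⇒ c ] = asgns c
  asgnsG (e ⇒ c ∷ gs) = asgns c ++ asgnsG gs

mutual
  havocs : Cmd → List Var
  havocs (skip n) = []
  havocs (assign n x e) = []
  havocs (havoc n x) = [ x ]
  havocs (c ⨾ d) = havocs c ++ havocs d
  havocs (IF n gcs) = havocsG gcs
  havocs (DO n gcs) = havocsG gcs

  havocsG : GCs → List Var
  havocsG [ e ⇒ c ] = havocs c
  havocsG (e ⇒ c ∷ gs) = havocs c ++ havocsG gs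

mutual
  vars : Cmd → List Var
  vars (skip n) = []
  vars (assign n x e) = x ∷ fvA e
  vars (havoc n x) = [ x ]
  vars (c ⨾ d) = vars c ++ vars d
  vars (IF n gcs) = varsG gcs
  vars (DO n gcs) = varsG gcs

  varsG : GCs → List Var
  varsG [ e ⇒ c ] = fvB e ++ vars c
  varsG (e ⇒ c ∷ gs) = fvB e ++ vars c ++ varsG gs

mutual
  WF : Cmd → Set
  WF (skip n) = ⊤
  WF (assign n x e) = ⊤
  WF (havoc n x) = ⊤
  WF (c ⨾ d) = WF c × WF d
  WF (IF n gcs) = (∀ s → ⟦ enab gcs ⟧B s ≡ true) × WFG gcs
  WF (DO n gcs) = WFG gcs

  WFG : GCs → Set
  WFG [ e ⇒ c ] = WF c
  WFG (e ⇒ c ∷ gs) = WF c × WFG gs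

Okf : Cmd → Label → Set
Okf c f = All (λ n → + 0 < n) (labs c) × Unique (labs c) × f ∉ labs c

CtrlPt : Cmd → Label → Label → Set
CtrlPt c f i = i ∈ labs c ⊎ i ≡ f

-- sub(n,c) and fsuc(n,c,f)  (total/partial functions; only meaningful
-- under okf(c,f), where they coincide with the paper's definitions)

mutual
  sub : Label → Cmd → Maybe Cmd
  sub n (skip k) = if does (n ℤP.≟ k) then just (skip k) else nothing
  sub n (assign k x e) = if does (n ℤP.≟ k) then just (assign k x e) else nothing
  sub n (havoc k x) = if does (n ℤP.≟ k) then just (havoc k x) else nothing
  sub n (c ⨾ d) = if does (n ∈? labs c) then sub n c else sub n d
  sub n (IF k gcs) = if does (n ℤP.≟ k) then just (IF k gcs) else subG n gcs
  sub n (DO k gcs) = if does (n ℤP.≟ k) then just (DO k gcs) else subG n gcs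

  subG : Label → GCs → Maybe Cmd
  subG n [ e ⇒ c ] = sub n c
  subG n (e ⇒ c ∷ gs) = if does (n ∈? labs c) then sub n c else subG n gs

mutual
  fsuc : Label → Cmd → Label → Label
  fsuc n (skip k) f = f
  fsuc n (assign k x e) f = f
  fsuc n (havoc k x) f = f
  fsuc n (c ⨾ d) f = if does (n ∈? labs c) then fsuc n c (lab d) else fsuc n d f
  fsuc n (IF k gcs) f = if does (n ℤP.≟ k) then f else fsucG n gcs f
  fsuc n (DO k gcs) f = if does (n ℤP.≟ k) then f else fsucG n gcs k

  fsucG : Label → GCs → Label → Label
  fsucG n [ e ⇒ c ] f = fsuc n c f
  fsucG n (e ⇒ c ∷ gs) f = if does (n ∈? labs c) then fsuc n c f else fsucG n gs f

-- Small-step semantics  ⟨c,s⟩ ⇝ ⟨d,t⟩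

data Step : Cmd → Store → Cmd → Store → Set where
  s-havoc  : ∀ {n x s} (v : ℤ) → Step (havoc n x) s (skip (- n)) (upd s x v)
  s-assign : ∀ {n x e s} → Step (assign n x e) s (skip (- n)) (upd s x (⟦ e ⟧A s))
  s-skip   : ∀ {n c s} → Step (skip n ⨾ c) s c s
  s-if     : ∀ {n gcs e c s} → (e , c) ∈ gcList gcs → ⟦ e ⟧B s ≡ true →
             Step (IF n gcs) s c s
  s-do     : ∀ {n gcs e c s} → (e , c) ∈ gcList gcs → ⟦ e ⟧B s ≡ true →
             Step (DO n gcs) s (c ⨾ DO n gcs) s
  s-od     : ∀ {n gcs s} → ⟦ enab gcs ⟧B s ≡ false →
             Step (DO n gcs) s (skip (- n)) s
  s-seq    : ∀ {c b d s t} → Step c s d t → Step (c ⨾ b) s (d ⨾ b) t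

-- The automaton aut(c,f): transitions (n,s) → (m,t)

data Trans (c : Cmd) (f : Label) : Label → Store → Label → Store → Set where
  t-pos  : ∀ {n s d d' t} → sub n c ≡ just d → Step d s d' t →
           + 0 < lab d' → Trans c f n s (lab d') t
  t-neg  : ∀ {n s d d' t} → sub n c ≡ just d → Step d s d' t →
           lab d' < + 0 → Trans c f n s (fsuc n c f) t
  t-skip : ∀ {n s} → sub n c ≡ just (skip n) → Trans c f n s (fsuc n c f) s

Assn : Set₁
Assn = Store → Set

-- extensionality: assertions are sets of (extensional) functions
Ext : Assn → Set
Ext P = ∀ {s t} → (∀ x → s x ≡ t x) → P s → P t

_⇛_ : Assn → Assn → Set
P ⇛ Q = ∀ s → P s → Q s

_∩_ : Assn → Assn → Assn
(P ∩ Q) s = P s × Q s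

∁ : Assn → Assn
∁ P s = ¬ P s

⟪_⟫ : BExp → Assn
⟪ e ⟫ s = ⟦ e ⟧B s ≡ true

_[_≔_] : Assn → Var → AExp → Assn
(P [ x ≔ e ]) s = P (upd s x (⟦ e ⟧A s))

All[_]_ : Var → Assn → Assn
(All[ x ] P) s = ∀ v → P (upd s x v)

indep : Var → Assn → Set
indep x P = ∀ s → P s ⇔ (∃ λ v → P (upd s x v))

AnnotFor : Cmd → Label → (Label → Assn) → Assn → Assn → Set
AnnotFor c f an P Q = (∀ s → an (lab c) s ⇔ P s) × (∀ s → an f s ⇔ Q s)

Valid : Cmd → Label → (Label → Assn) → Set
Valid c f an = ∀ {n s m t} → an n s → Trans c f n s m t → an m t

mutual
  Ghost : Var → Cmd → Set
  Ghost x (skip n) = ⊤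
  Ghost x (assign n y e) = x ∉ fvA e
  Ghost x (havoc n y) = ⊤
  Ghost x (c ⨾ d) = Ghost x c × Ghost x d
  Ghost x (IF n gcs) = GhostG x gcs
  Ghost x (DO n gcs) = GhostG x gcs

  GhostG : Var → GCs → Set
  GhostG x [ e ⇒ c ] = x ∉ fvB e × Ghost x c
  GhostG x (e ⇒ c ∷ gs) = x ∉ fvB e × Ghost x c × GhostG x gs

mutual
  erase : Var → Cmd → Cmd
  erase x (skip n) = skip n
  erase x (assign n y e) = if does (y ℕP.≟ x) then skip n else assign n y e
  erase x (havoc n y) = if does (y ℕP.≟ x) then skip n else havoc n y
  erase x (c ⨾ d) = erase x c ⨾ erase x d
  erase x (IF n gcs) = IF n (eraseG x gcs)
  erase x (DO n gcs) = DO n (eraseG x gcs)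

  eraseG : Var → GCs → GCs
  eraseG x [ e ⇒ c ] = [ e ⇒ erase x c ]
  eraseG x (e ⇒ c ∷ gs) = e ⇒ erase x c ∷ eraseG x gs

-- Kleene algebra with tests

data Act : Set where
  actAsg : Var → AExp → Act
  actHav : Var → Act

data Tst : Set where
  tprim : Prim → Tst
  t0 t1 : Tst
  tneg  : Tst → Tst
  tand  : Tst → Tst → Tst
  tor   : Tst → Tst → Tst

infixl 7 _·_
infixl 6 _⊹_

data KT : Set where
  act  : Act → KT
  tst  : Tst → KT
  _·_  : KT → KT → KT
  _⊹_  : KT → KT → KT
  star : KT → KT

𝟘 𝟙 : KT
𝟘 = tst t0
𝟙 = tst t1

⌊_⌋B : BExp → Tst
⌊ prim p ⌋B = tprim p
⌊ band a b ⌋B = tand ⌊ a ⌋B ⌊ b ⌋B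
⌊ bor a b ⌋B = tor ⌊ a ⌋B ⌊ b ⌋B
⌊ bnot a ⌋B = tneg ⌊ a ⌋B

mutual
  ⌊_⌋ : Cmd → KT
  ⌊ skip n ⌋ = 𝟙
  ⌊ assign n x e ⌋ = act (actAsg x e)
  ⌊ havoc n x ⌋ = act (actHav x)
  ⌊ c ⨾ d ⌋ = ⌊ c ⌋ · ⌊ d ⌋
  ⌊ IF n gcs ⌋ = ⌊ gcs ⌋G
  ⌊ DO n gcs ⌋ = star ⌊ gcs ⌋G · tst (tneg ⌊ enab gcs ⌋B)

  ⌊_⌋G : GCs → KT
  ⌊ [ e ⇒ c ] ⌋G = tst ⌊ e ⌋B · ⌊ c ⌋
  ⌊ e ⇒ c ∷ gs ⌋G = tst ⌊ e ⌋B · ⌊ c ⌋ ⊹ ⌊ gs ⌋G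

infix 4 Hyp⊢_≈_

data Hyp⊢_≈_ : KT → KT → Set where
  refl  : ∀ {x} → Hyp⊢ x ≈ x
  sym   : ∀ {x y} → Hyp⊢ x ≈ y → Hyp⊢ y ≈ x
  trans : ∀ {x y z} → Hyp⊢ x ≈ y → Hyp⊢ y ≈ z → Hyp⊢ x ≈ z
  ·-cong : ∀ {x x' y y'} → Hyp⊢ x ≈ x' → Hyp⊢ y ≈ y' → Hyp⊢ x · y ≈ x' · y'
  ⊹-cong : ∀ {x x' y y'} → Hyp⊢ x ≈ x' → Hyp⊢ y ≈ y' → Hyp⊢ x ⊹ y ≈ x' ⊹ y'
  *-cong : ∀ {x y} → Hyp⊢ x ≈ y → Hyp⊢ star x ≈ star y
  ¬-cong : ∀ {a b} → Hyp⊢ tst a ≈ tst b → Hyp⊢ tst (tneg a) ≈ tst (tneg b)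
  ⊹-assoc : ∀ {x y z} → Hyp⊢ (x ⊹ y) ⊹ z ≈ x ⊹ (y ⊹ z)
  ⊹-comm  : ∀ {x y} → Hyp⊢ x ⊹ y ≈ y ⊹ x
  ⊹-idem  : ∀ {x} → Hyp⊢ x ⊹ x ≈ x
  ⊹-zero  : ∀ {x} → Hyp⊢ x ⊹ 𝟘 ≈ x
  ·-assoc : ∀ {x y z} → Hyp⊢ (x · y) · z ≈ x · (y · z)
  ·-idˡ   : ∀ {x} → Hyp⊢ 𝟙 · x ≈ x
  ·-idʳ   : ∀ {x} → Hyp⊢ x · 𝟙 ≈ x
  ·-zeroˡ : ∀ {x} → Hyp⊢ 𝟘 · x ≈ 𝟘
  ·-zeroʳ : ∀ {x} → Hyp⊢ x · 𝟘 ≈ 𝟘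
  distribˡ : ∀ {x y z} → Hyp⊢ x · (y ⊹ z) ≈ x · y ⊹ x · z
  distribʳ : ∀ {x y z} → Hyp⊢ (x ⊹ y) · z ≈ x · z ⊹ y · z
  -- star  (x ≤ y  abbreviates  x + y = y)
  *-unfoldˡ : ∀ {x} → Hyp⊢ 𝟙 ⊹ x · star x ≈ star x
  *-unfoldʳ : ∀ {x} → Hyp⊢ 𝟙 ⊹ star x · x ≈ star x
  *-indˡ : ∀ {x y z} → Hyp⊢ (y ⊹ x · z) ⊹ z ≈ z → Hyp⊢ star x · y ⊹ z ≈ z
  *-indʳ : ∀ {x y z} → Hyp⊢ (y ⊹ z · x) ⊹ z ≈ z → Hyp⊢ y · star x ⊹ z ≈ z
  tand-def : ∀ {a b} → Hyp⊢ tst (tand a b) ≈ tst a · tst b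
  tor-def  : ∀ {a b} → Hyp⊢ tst (tor a b) ≈ tst a ⊹ tst b
  t-·-comm : ∀ {a b} → Hyp⊢ tst a · tst b ≈ tst b · tst a
  t-·-idem : ∀ {a} → Hyp⊢ tst a · tst a ≈ tst a
  t-absorb₁ : ∀ {a b} → Hyp⊢ tst a ⊹ tst a · tst b ≈ tst a
  t-absorb₂ : ∀ {a b} → Hyp⊢ tst a · (tst a ⊹ tst b) ≈ tst a
  t-distrib : ∀ {a b c} → Hyp⊢ tst a ⊹ tst b · tst c ≈ (tst a ⊹ tst b) · (tst a ⊹ tst c)
  t-compl⊹ : ∀ {a} → Hyp⊢ tst a ⊹ tst (tneg a) ≈ 𝟙
  t-compl· : ∀ {a} → Hyp⊢ tst a · tst (tneg a) ≈ 𝟘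
  hyp-unsat : ∀ {e} → (∀ s → ⟦ e ⟧B s ≡ false) → Hyp⊢ tst ⌊ e ⌋B ≈ 𝟘
  hyp-asg   : ∀ {e₀ x e e₁} →
              (∀ s → ⟦ e₀ ⟧B s ≡ true → ⟦ e₁ ⟧B (upd s x (⟦ e ⟧A s)) ≡ true) →
              Hyp⊢ tst ⌊ e₀ ⌋B · act (actAsg x e) · tst (tneg ⌊ e₁ ⌋B) ≈ 𝟘
  hyp-hav   : ∀ {e₀ x e₁} →
              (∀ s → ⟦ e₀ ⟧B s ≡ true → ∀ v → ⟦ e₁ ⟧B (upd s x v) ≡ true) →
              Hyp⊢ tst ⌊ e₀ ⌋B · act (actHav x) · tst (tneg ⌊ e₁ ⌋B) ≈ 𝟘

_≃_ : Cmd → Cmd → Set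
c ≃ d = Hyp⊢ ⌊ c ⌋ ≈ ⌊ d ⌋

-- HL+ derivations, restricted to assertions in a class  A.
-- Every judgment  c : {P}{Q}  in the derivation tree must have A P and A Q.
-- (With A = λ _ → ⊤ this is plain HL+.)

data HL+ (A : Assn → Set) : Cmd → Assn → Assn → Set₁ where
  Skip    : ∀ {n P} → A P → HL+ A (skip n) P P
  Asgn    : ∀ {n x e P} → A (P [ x ≔ e ]) → A P →
            HL+ A (assign n x e) (P [ x ≔ e ]) P
  Havoc   : ∀ {n x P} → A (All[ x ] P) → A P →
            HL+ A (havoc n x) (All[ x ] P) P
  Seq     : ∀ {c d P R Q} → A P → A Q →
            HL+ A c P R → HL+ A d R Q → HL+ A (c ⨾ d) P Q
  If      : ∀ {n gcs P Q} → A P → A Q →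
            (∀ {e c} → (e , c) ∈ gcList gcs → HL+ A c (P ∩ ⟪ e ⟫) Q) →
            HL+ A (IF n gcs) P Q
  Do      : ∀ {n gcs P} → A P → A (P ∩ ∁ ⟪ enab gcs ⟫) →
            (∀ {e c} → (e , c) ∈ gcList gcs → HL+ A c (⟪ e ⟫ ∩ P) P) →
            HL+ A (DO n gcs) P (P ∩ ∁ ⟪ enab gcs ⟫)
  Conseq  : ∀ {c P P' Q' Q} → A P → A Q →
            P ⇛ P' → HL+ A c P' Q' → Q' ⇛ Q → HL+ A c P Q
  GhostR  : ∀ {x c P Q} → A P → A Q →
            HL+ A c P Q → Ghost x c → indep x P → indep x Q →
            HL+ A (erase x c) P Q
  Rewrite : ∀ {c d P Q} → A P → A Q →
            WF c → HL+ A c P Q → c ≃ d → HL+ A d P Q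

data Atom : Set where
  aAn  : Label → Atom
  aB   : BExp → Atom
  aPc  : ℤ → Atom
  aSub : Label → Var → AExp → Atom
  aHav : Label → Var → Atom

data Form : Set where
  atom : Atom → Form
  ftrue : Form
  fnot : Form → Form
  fand : Form → Form → Form
  for  : Form → Form → Form

AtomOK : Cmd → Label → Atom → Set
AtomOK c f (aAn i) = CtrlPt c f i
AtomOK c f (aB b) = Σ BExp λ g → g ∈ guards c × SubB b g
AtomOK c f (aPc n) = ⊤
AtomOK c f (aSub i x e) = CtrlPt c f i × (x , e) ∈ asgns c
AtomOK c f (aHav i x) = CtrlPt c f i × x ∈ havocs c

FormOK : Cmd → Label → Form → Set
FormOK c f (atom a) = AtomOK c f a
FormOK c f ftrue = ⊤
FormOK c f (fnot φ) = FormOK c f φ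
FormOK c f (fand φ ψ) = FormOK c f φ × FormOK c f ψ
FormOK c f (for φ ψ) = FormOK c f φ × FormOK c f ψ

⟦_⟧At : Atom → Var → (Label → Assn) → Assn
⟦ aAn i ⟧At pc an = an i
⟦ aB b ⟧At pc an = ⟪ b ⟫
⟦ aPc n ⟧At pc an s = s pc ≡ n
⟦ aSub i x e ⟧At pc an = an i [ x ≔ e ]
⟦ aHav i x ⟧At pc an = All[ x ] an i

⟦_⟧F : Form → Var → (Label → Assn) → Assn
⟦ atom a ⟧F pc an = ⟦ a ⟧At pc an
⟦ ftrue ⟧F pc an s = ⊤
⟦ fnot φ ⟧F pc an = ∁ (⟦ φ ⟧F pc an)
⟦ fand φ ψ ⟧F pc an = ⟦ φ ⟧F pc an ∩ ⟦ ψ ⟧F pc an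
⟦ for φ ψ ⟧F pc an s = ⟦ φ ⟧F pc an s ⊎ ⟦ ψ ⟧F pc an s

Derived : Var → Cmd → Label → (Label → Assn) → Assn → Set
Derived pc c f an P =
  Σ Form λ φ → FormOK c f φ × (∀ s → P s ⇔ ⟦ φ ⟧F pc an s)

Fresh : Var → Cmd → Label → (Label → Assn) → Set
Fresh pc c f an = pc ∉ vars c × (∀ i → CtrlPt c f i → indep pc (an i))

{-# OPTIONS --safe #-}
-- Each subcommand d, with the label k where control goes after it, has an
-- automaton aut(d, k) that is a sub-automaton of aut(c, f), so an is a valid
-- annotation of it, and induction on d gives d : {an (lab d)} {an k}.  Each
-- proof rule is instantiated with the annotations at the entry and exit of d;
-- the side conditions of Conseq are single transitions of the automaton, which
-- validity discharges.

module Submission where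

open import Defs
open import Data.Integer using (ℤ)

open import Data.Bool using (true; if_then_else_; _∨_)
open import Data.Bool.Properties using (T-≡; T-∨; ¬-not)
open import Data.Integer using (+_; -_; _<_)
import Data.Integer.Properties as ℤP
open import Data.List using (List; []; _∷_; _++_)
open import Data.List.Membership.Propositional using (_∈_; _∉_)
open import Data.List.Membership.DecPropositional ℤP._≟_ using (_∈?_)
open import Data.List.Relation.Binary.Disjoint.Propositional using (Disjoint)
open import Data.List.Relation.Binary.Subset.Propositional using (_⊆_)
open import Data.List.Relation.Binary.Subset.Propositional.Properties
  using (⊆-refl; ⊆-trans; ∷⁺ʳ; xs⊆x∷xs; xs⊆xs++ys; xs⊆ys++xs)
open import Data.List.Relation.Unary.All as All using (All)
import Data.List.Relation.Unary.All.Properties as All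
open import Data.List.Relation.Unary.AllPairs using ([]; _∷_)
open import Data.List.Relation.Unary.Any using (here; there)
open import Data.List.Relation.Unary.Unique.Propositional using (Unique)
open import Data.Maybe using (just)
open import Data.Product using (_×_; _,_; proj₁; proj₂)
open import Data.Product.Function.NonDependent.Propositional using (_×-⇔_)
open import Data.Sum using (_⊎_; inj₁; inj₂)
open import Data.Sum.Function.Propositional using (_⊎-⇔_)
open import Function.Base using (_∘_)
open import Function.Bundles using (_⇔_; mk⇔; Equivalence)
open import Function.Construct.Composition using (_⇔-∘_)
open import Function.Construct.Identity using (⇔-id)
open import Function.Construct.Symmetry using (⇔-sym)
open import Relation.Nullary using (does; yes; no)
open import Relation.Nullary.Decidable using (dec-true; dec-false)
open import Relation.Binary.PropositionalEquality as ≡ using (_≡_; _≢_; refl)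

Unique-++⁻ : ∀ {A : Set} (xs : List A) {ys} → Unique (xs ++ ys) →
             Unique xs × Unique ys × Disjoint xs ys
Unique-++⁻ []       u         = [] , u , λ { (() , _) }
Unique-++⁻ (x ∷ xs) (x∉ ∷ u) with Unique-++⁻ xs u
... | u₁ , u₂ , disj = All.++⁻ˡ xs x∉ ∷ u₁ , u₂ , λ
  { (here refl , q) → All.lookup (All.++⁻ʳ xs x∉) q refl
  ; (there p , q)   → disj (p , q) }

∨-≡true⇔ : ∀ {a b} → (a ∨ b) ≡ true ⇔ (a ≡ true ⊎ b ≡ true)
∨-≡true⇔ = (T-≡ ⊎-⇔ T-≡) ⇔-∘ (T-∨ ⇔-∘ ⇔-sym T-≡)

if-≟-refl : ∀ {A : Set} n (x y : A) → (if does (n ℤP.≟ n) then x else y) ≡ x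
if-≟-refl n x y rewrite dec-true (n ℤP.≟ n) refl = refl

if-≟-≢ : ∀ {A : Set} {m n} (x y : A) → m ≢ n → (if does (m ℤP.≟ n) then x else y) ≡ y
if-≟-≢ {m = m} {n} x y m≢n rewrite dec-false (m ℤP.≟ n) m≢n = refl

if-∈?-yes : ∀ {A : Set} {n ns} (x y : A) → n ∈ ns → (if does (n ∈? ns) then x else y) ≡ x
if-∈?-yes {n = n} {ns} x y n∈ rewrite dec-true (n ∈? ns) n∈ = refl

if-∈?-no : ∀ {A : Set} {n ns} (x y : A) → n ∉ ns → (if does (n ∈? ns) then x else y) ≡ y
if-∈?-no {n = n} {ns} x y n∉ rewrite dec-false (n ∈? ns) n∉ = refl

lab∈labs : ∀ c → lab c ∈ labs c
lab∈labs (skip n)       = here refl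
lab∈labs (assign n x e) = here refl
lab∈labs (havoc n x)    = here refl
lab∈labs (c ⨾ d)        = xs⊆xs++ys (labs c) (labs d) (lab∈labs c)
lab∈labs (IF n gcs)     = here refl
lab∈labs (DO n gcs)     = here refl

mutual
  sub≡just⇒∈labs : ∀ {n} c {d} → sub n c ≡ just d → n ∈ labs c
  sub≡just⇒∈labs {n} (skip k)       eq with n ℤP.≟ k
  sub≡just⇒∈labs     (skip k)       eq  | yes refl = here refl
  sub≡just⇒∈labs     (skip k)       () | no _
  sub≡just⇒∈labs {n} (assign k x e) eq with n ℤP.≟ k
  sub≡just⇒∈labs     (assign k x e) eq  | yes refl = here refl
  sub≡just⇒∈labs     (assign k x e) () | no _
  sub≡just⇒∈labs {n} (havoc k x)    eq with n ℤP.≟ k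
  sub≡just⇒∈labs     (havoc k x)    eq  | yes refl = here refl
  sub≡just⇒∈labs     (havoc k x)    () | no _
  sub≡just⇒∈labs {n} (c ⨾ d)        eq with n ∈? labs c
  ... | yes n∈c = xs⊆xs++ys (labs c) (labs d) n∈c
  ... | no _    = xs⊆ys++xs (labs d) (labs c) (sub≡just⇒∈labs d eq)
  sub≡just⇒∈labs {n} (IF k gcs)     eq with n ℤP.≟ k
  ... | yes refl = here refl
  ... | no _     = there (subG≡just⇒∈labsG gcs eq)
  sub≡just⇒∈labs {n} (DO k gcs)     eq with n ℤP.≟ k
  ... | yes refl = here refl
  ... | no _     = there (subG≡just⇒∈labsG gcs eq)

  subG≡just⇒∈labsG : ∀ {n} gcs {d} → subG n gcs ≡ just d → n ∈ labsG gcs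
  subG≡just⇒∈labsG [ e ⇒ c ]        eq = sub≡just⇒∈labs c eq
  subG≡just⇒∈labsG {n} (e ⇒ c ∷ gs) eq with n ∈? labs c
  ... | yes n∈c = xs⊆xs++ys (labs c) (labsG gs) n∈c
  ... | no _    = xs⊆ys++xs (labsG gs) (labs c) (subG≡just⇒∈labsG gs eq)

record _⊑_ (d c : Cmd) : Set where
  field
    labs⊆   : labs d ⊆ labs c
    guards⊆ : guards d ⊆ guards c
    asgns⊆  : asgns d ⊆ asgns c
    havocs⊆ : havocs d ⊆ havocs c
open _⊑_

⊑-refl : ∀ {c} → c ⊑ c
⊑-refl = record { labs⊆ = ⊆-refl ; guards⊆ = ⊆-refl ; asgns⊆ = ⊆-refl ; havocs⊆ = ⊆-refl }

⊑-trans : ∀ {c d e} → c ⊑ d → d ⊑ e → c ⊑ e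
⊑-trans c⊑d d⊑e = record
  { labs⊆   = ⊆-trans (labs⊆ c⊑d) (labs⊆ d⊑e)
  ; guards⊆ = ⊆-trans (guards⊆ c⊑d) (guards⊆ d⊑e)
  ; asgns⊆  = ⊆-trans (asgns⊆ c⊑d) (asgns⊆ d⊑e)
  ; havocs⊆ = ⊆-trans (havocs⊆ c⊑d) (havocs⊆ d⊑e)
  }

⊑-⨾ˡ : ∀ c d → c ⊑ (c ⨾ d)
⊑-⨾ˡ c d = record
  { labs⊆   = xs⊆xs++ys (labs c) (labs d)
  ; guards⊆ = xs⊆xs++ys (guards c) (guards d)
  ; asgns⊆  = xs⊆xs++ys (asgns c) (asgns d)
  ; havocs⊆ = xs⊆xs++ys (havocs c) (havocs d)
  }

⊑-⨾ʳ : ∀ c d → d ⊑ (c ⨾ d)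
⊑-⨾ʳ c d = record
  { labs⊆   = xs⊆ys++xs (labs d) (labs c)
  ; guards⊆ = xs⊆ys++xs (guards d) (guards c)
  ; asgns⊆  = xs⊆ys++xs (asgns d) (asgns c)
  ; havocs⊆ = xs⊆ys++xs (havocs d) (havocs c)
  }

IF-⊑-IF-∷ : ∀ {n e c} gcs → IF n gcs ⊑ IF n (e ⇒ c ∷ gcs)
IF-⊑-IF-∷ {n} {e} {c} gcs = record
  { labs⊆   = ∷⁺ʳ n (xs⊆ys++xs (labsG gcs) (labs c))
  ; guards⊆ = ⊆-trans (xs⊆ys++xs (guardsG gcs) (guards c)) (xs⊆x∷xs _ e)
  ; asgns⊆  = xs⊆ys++xs (asgnsG gcs) (asgns c)
  ; havocs⊆ = xs⊆ys++xs (havocsG gcs) (havocs c)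
  }

IF-⊑-DO : ∀ {n} gcs → IF n gcs ⊑ DO n gcs
IF-⊑-DO gcs = record { labs⊆ = ⊆-refl ; guards⊆ = ⊆-refl ; asgns⊆ = ⊆-refl ; havocs⊆ = ⊆-refl }

branch-⊑-IF : ∀ {n} gcs {e c} → (e , c) ∈ gcList gcs → c ⊑ IF n gcs
branch-⊑-IF {n} [ e ⇒ c ] (here refl) = record
  { labs⊆ = xs⊆x∷xs (labs c) n ; guards⊆ = xs⊆x∷xs (guards c) e
  ; asgns⊆ = ⊆-refl ; havocs⊆ = ⊆-refl }
branch-⊑-IF {n} (e ⇒ c ∷ gs) (here refl) = record
  { labs⊆   = ⊆-trans (xs⊆xs++ys (labs c) (labsG gs)) (xs⊆x∷xs _ n)
  ; guards⊆ = ⊆-trans (xs⊆xs++ys (guards c) (guardsG gs)) (xs⊆x∷xs _ e)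
  ; asgns⊆  = xs⊆xs++ys (asgns c) (asgnsG gs)
  ; havocs⊆ = xs⊆xs++ys (havocs c) (havocsG gs)
  }
branch-⊑-IF (e ⇒ c ∷ gs) (there mem) = ⊑-trans (branch-⊑-IF gs mem) (IF-⊑-IF-∷ gs)

guard∈guardsG : ∀ gcs {e c} → (e , c) ∈ gcList gcs → e ∈ guardsG gcs
guard∈guardsG [ e ⇒ c ]      (here refl) = here refl
guard∈guardsG (e ⇒ c ∷ gs)   (here refl) = here refl
guard∈guardsG (e ⇒ c ∷ gs)   (there mem) =
  there (xs⊆ys++xs (guardsG gs) (guards c) (guard∈guardsG gs mem))

branch-labs⊆ : ∀ gcs {e c} → (e , c) ∈ gcList gcs → labs c ⊆ labsG gcs
branch-labs⊆ [ e ⇒ c ]    (here refl) = ⊆-refl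
branch-labs⊆ (e ⇒ c ∷ gs) (here refl) = xs⊆xs++ys (labs c) (labsG gs)
branch-labs⊆ (e ⇒ c ∷ gs) (there mem) =
  ⊆-trans (branch-labs⊆ gs mem) (xs⊆ys++xs (labsG gs) (labs c))

Unique-branch : ∀ gcs {e c} → Unique (labsG gcs) → (e , c) ∈ gcList gcs → Unique (labs c)
Unique-branch [ e ⇒ c ]    u (here refl) = u
Unique-branch (e ⇒ c ∷ gs) u (here refl) = proj₁ (Unique-++⁻ (labs c) u)
Unique-branch (e ⇒ c ∷ gs) u (there mem) =
  Unique-branch gs (proj₁ (proj₂ (Unique-++⁻ (labs c) u))) mem

branch-sub-fsuc : ∀ gcs {e c n} → Unique (labsG gcs) → (e , c) ∈ gcList gcs → n ∈ labs c →
                  subG n gcs ≡ sub n c × (∀ k → fsucG n gcs k ≡ fsuc n c k)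
branch-sub-fsuc [ e ⇒ c ]    u (here refl) n∈c = refl , λ k → refl
branch-sub-fsuc (e ⇒ c ∷ gs) u (here refl) n∈c =
  if-∈?-yes _ _ n∈c , λ k → if-∈?-yes _ _ n∈c
branch-sub-fsuc (e ⇒ c ∷ gs) u (there mem) n∈cᵢ
  with Unique-++⁻ (labs c) u
... | _ , u-gs , disj with branch-sub-fsuc gs u-gs mem n∈cᵢ
...   | sub≡ , fsuc≡ =
  ≡.trans (if-∈?-no _ _ n∉c) sub≡ , λ k → ≡.trans (if-∈?-no _ _ n∉c) (fsuc≡ k)
  where n∉c = λ n∈c → disj (n∈c , branch-labs⊆ gs mem n∈cᵢ)

branch-entry : ∀ {n} gcs {e c m d} → Unique (n ∷ labsG gcs) → (e , c) ∈ gcList gcs →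
               sub m c ≡ just d →
               m ≢ n × subG m gcs ≡ just d × (∀ k → fsucG m gcs k ≡ fsuc m c k)
branch-entry gcs {c = c} (n∉ ∷ u) mem eq =
  (λ m≡n → All.lookup n∉ (branch-labs⊆ gcs mem m∈c) (≡.sym m≡n)) ,
  ≡.trans (proj₁ sub-fsuc) eq , proj₂ sub-fsuc
  where
  m∈c = sub≡just⇒∈labs c eq
  sub-fsuc = branch-sub-fsuc gcs u mem m∈c

-- aut(d, k) is a sub-automaton of aut(c, k′).
Embeds : Cmd → Label → Cmd → Label → Set
Embeds d k c k′ = ∀ {n e} → sub n d ≡ just e → sub n c ≡ just e × fsuc n c k′ ≡ fsuc n d k

Trans-embed : ∀ {d k c k′ n s m t} → Embeds d k c k′ → Trans d k n s m t → Trans c k′ n s m t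
Trans-embed emb (t-pos eq step pos) = t-pos (proj₁ (emb eq)) step pos
Trans-embed emb (t-neg eq step neg) with emb eq
... | eq′ , fsuc≡ = ≡.subst (λ m → Trans _ _ _ _ m _) fsuc≡ (t-neg eq′ step neg)
Trans-embed emb (t-skip eq) with emb eq
... | eq′ , fsuc≡ = ≡.subst (λ m → Trans _ _ _ _ m _) fsuc≡ (t-skip eq′)

Valid-embed : ∀ {d k c k′ an} → Embeds d k c k′ → Valid c k′ an → Valid d k an
Valid-embed emb valid p tr = valid p (Trans-embed emb tr)

Embeds-⨾ˡ : ∀ c₁ c₂ k → Embeds c₁ (lab c₂) (c₁ ⨾ c₂) k
Embeds-⨾ˡ c₁ c₂ k eq = ≡.trans (if-∈?-yes _ _ n∈c₁) eq , if-∈?-yes _ _ n∈c₁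
  where n∈c₁ = sub≡just⇒∈labs c₁ eq

Embeds-⨾ʳ : ∀ c₁ c₂ k → Disjoint (labs c₁) (labs c₂) → Embeds c₂ k (c₁ ⨾ c₂) k
Embeds-⨾ʳ c₁ c₂ k disj eq = ≡.trans (if-∈?-no _ _ n∉c₁) eq , if-∈?-no _ _ n∉c₁
  where n∉c₁ = λ n∈c₁ → disj (n∈c₁ , sub≡just⇒∈labs c₂ eq)

Embeds-IF : ∀ {n gcs e c} k → Unique (labs (IF n gcs)) → (e , c) ∈ gcList gcs →
            Embeds c k (IF n gcs) k
Embeds-IF {gcs = gcs} k u mem eq with branch-entry gcs u mem eq
... | m≢n , sub≡ , fsuc≡ = ≡.trans (if-≟-≢ _ _ m≢n) sub≡ , ≡.trans (if-≟-≢ _ _ m≢n) (fsuc≡ k)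

Embeds-DO : ∀ {n gcs e c} k → Unique (labs (DO n gcs)) → (e , c) ∈ gcList gcs →
            Embeds c n (DO n gcs) k
Embeds-DO {n} {gcs} k u mem eq with branch-entry gcs u mem eq
... | m≢n , sub≡ , fsuc≡ = ≡.trans (if-≟-≢ _ _ m≢n) sub≡ , ≡.trans (if-≟-≢ _ _ m≢n) (fsuc≡ n)

module Derivable (pc : Var) (c : Cmd) (f : Label) (an : Label → Assn) where

  D : Assn → Set
  D = Derived pc c f an

  D-resp-⇔ : ∀ {P Q} → (∀ s → P s ⇔ Q s) → D P → D Q
  D-resp-⇔ P⇔Q (φ , ok , P⇔φ) = φ , ok , λ s → P⇔φ s ⇔-∘ ⇔-sym (P⇔Q s)

  D-∩ : ∀ {P Q} → D P → D Q → D (P ∩ Q)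
  D-∩ (φ , okφ , P⇔φ) (ψ , okψ , Q⇔ψ) = fand φ ψ , (okφ , okψ) , λ s → P⇔φ s ×-⇔ Q⇔ψ s

  D-∪ : ∀ {P Q} → D P → D Q → D (λ s → P s ⊎ Q s)
  D-∪ (φ , okφ , P⇔φ) (ψ , okψ , Q⇔ψ) = for φ ψ , (okφ , okψ) , λ s → P⇔φ s ⊎-⇔ Q⇔ψ s

  D-∁ : ∀ {P} → D P → D (∁ P)
  D-∁ (φ , ok , P⇔φ) = fnot φ , ok , λ s →
    mk⇔ (λ ¬p x → ¬p (Equivalence.from (P⇔φ s) x)) (λ ¬x p → ¬x (Equivalence.to (P⇔φ s) p))

  D-an : ∀ {i} → CtrlPt c f i → D (an i)
  D-an {i} i∈ = atom (aAn i) , i∈ , λ s → ⇔-id _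

  D-guard : ∀ {e} → e ∈ guards c → D ⟪ e ⟫
  D-guard {e} e∈ = atom (aB e) , (e , e∈ , here) , λ s → ⇔-id _

  D-enab : ∀ gcs → guardsG gcs ⊆ guards c → D ⟪ enab gcs ⟫
  D-enab [ e ⇒ _ ]     gcs⊆ = D-guard (gcs⊆ (here refl))
  D-enab (e ⇒ c′ ∷ gs) gcs⊆ = D-resp-⇔ (λ s → ⇔-sym ∨-≡true⇔)
    (D-∪ (D-guard (gcs⊆ (here refl)))
         (D-enab gs (⊆-trans (xs⊆ys++xs (guardsG gs) (guards c′)) (gcs⊆ ∘ there))))

  D-subst : ∀ {i x e} → CtrlPt c f i → (x , e) ∈ asgns c → D (an i [ x ≔ e ])
  D-subst {i} {x} {e} i∈ x≔e∈ = atom (aSub i x e) , (i∈ , x≔e∈) , λ s → ⇔-id _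

  D-∀ : ∀ {i x} → CtrlPt c f i → x ∈ havocs c → D (All[ x ] an i)
  D-∀ {i} {x} i∈ x∈ = atom (aHav i x) , (i∈ , x∈) , λ s → ⇔-id _

module FromValidAnnotation (c : Cmd) (f : Label) (an : Label → Assn) (pc : Var)
                           (labs-pos : All (+ 0 <_) (labs c)) where
  open Derivable pc c f an public

  D-entry : ∀ {d} → d ⊑ c → D (an (lab d))
  D-entry {d} d⊑c = D-an (inj₁ (labs⊆ d⊑c (lab∈labs d)))

  label-pos : ∀ {d n} → d ⊑ c → n ∈ labs d → + 0 < n
  label-pos d⊑c n∈d = All.lookup labs-pos (labs⊆ d⊑c n∈d)

  -- A step that consumes the whole command d lands on a negative label.
  done-neg : ∀ {d n} → d ⊑ c → n ∈ labs d → - n < + 0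
  done-neg d⊑c n∈d = ℤP.neg-mono-< (label-pos d⊑c n∈d)

  Conseq-pre : ∀ {d P P′ Q} → D P → D Q → P ⇛ P′ → HL+ D d P′ Q → HL+ D d P Q
  Conseq-pre dP dQ P⇛P′ ⊢d = Conseq dP dQ P⇛P′ ⊢d (λ _ q → q)

  mutual
    annotated⇒HL+ : ∀ d k → Unique (labs d) → d ⊑ c → CtrlPt c f k → Valid d k an →
                    HL+ D d (an (lab d)) (an k)
    annotated⇒HL+ (skip n) k u d⊑c k∈ valid =
      Conseq-pre (D-entry d⊑c) (D-an k∈)
        (λ s p → valid p (t-skip (if-≟-refl n _ _)))
        (Skip (D-an k∈))
    annotated⇒HL+ (assign n x e) k u d⊑c k∈ valid =
      Conseq-pre (D-entry d⊑c) (D-an k∈)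
        (λ s p → valid p (t-neg (if-≟-refl n _ _) s-assign (done-neg d⊑c (here refl))))
        (Asgn (D-subst k∈ (asgns⊆ d⊑c (here refl))) (D-an k∈))
    annotated⇒HL+ (havoc n x) k u d⊑c k∈ valid =
      Conseq-pre (D-entry d⊑c) (D-an k∈)
        (λ s p v → valid p (t-neg (if-≟-refl n _ _) (s-havoc v) (done-neg d⊑c (here refl))))
        (Havoc (D-∀ k∈ (havocs⊆ d⊑c (here refl))) (D-an k∈))
    annotated⇒HL+ (c₁ ⨾ c₂) k u d⊑c k∈ valid with Unique-++⁻ (labs c₁) u
    ... | u₁ , u₂ , disj =
      Seq (D-entry d⊑c) (D-an k∈)
        (annotated⇒HL+ c₁ (lab c₂) u₁ c₁⊑c (inj₁ (labs⊆ c₂⊑c (lab∈labs c₂)))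
          (Valid-embed (Embeds-⨾ˡ c₁ c₂ k) valid))
        (annotated⇒HL+ c₂ k u₂ c₂⊑c k∈ (Valid-embed (Embeds-⨾ʳ c₁ c₂ k disj) valid))
      where
      c₁⊑c = ⊑-trans (⊑-⨾ˡ c₁ c₂) d⊑c
      c₂⊑c = ⊑-trans (⊑-⨾ʳ c₁ c₂) d⊑c
    annotated⇒HL+ (IF n gcs) k u@(_ ∷ u-gcs) d⊑c k∈ valid =
      If (D-entry d⊑c) (D-an k∈) branch
      where
      branch : ∀ {e cᵢ} → (e , cᵢ) ∈ gcList gcs → HL+ D cᵢ (an n ∩ ⟪ e ⟫) (an k)
      branch {cᵢ = cᵢ} mem =
        Conseq-pre (D-∩ (D-entry d⊑c) (D-guard (guards⊆ d⊑c (guard∈guardsG gcs mem)))) (D-an k∈)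
          (λ s (p , g) → valid p (t-pos (if-≟-refl n _ _) (s-if mem g) (label-pos cᵢ⊑c (lab∈labs cᵢ))))
          (annotated⇒HL+-branch gcs mem k (Unique-branch gcs u-gcs mem) cᵢ⊑c k∈
            (Valid-embed (Embeds-IF k u mem) valid))
        where cᵢ⊑c = ⊑-trans (branch-⊑-IF gcs mem) d⊑c
    annotated⇒HL+ (DO n gcs) k u@(_ ∷ u-gcs) d⊑c k∈ valid =
      Conseq (D-entry d⊑c) (D-an k∈) (λ _ p → p)
        (Do (D-entry d⊑c) (D-∩ (D-entry d⊑c) (D-∁ (D-enab gcs (guards⊆ d⊑c)))) body)
        (λ s (p , ¬g) → ≡.subst (λ m → an m s) (if-≟-refl n _ _)
          (valid p (t-neg (if-≟-refl n _ _) (s-od (¬-not ¬g)) (done-neg d⊑c (here refl)))))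
      where
      body : ∀ {e cᵢ} → (e , cᵢ) ∈ gcList gcs → HL+ D cᵢ (⟪ e ⟫ ∩ an n) (an n)
      body {cᵢ = cᵢ} mem =
        Conseq-pre (D-∩ (D-guard (guards⊆ d⊑c (guard∈guardsG gcs mem))) (D-entry d⊑c)) (D-entry d⊑c)
          (λ s (g , p) → valid p (t-pos (if-≟-refl n _ _) (s-do mem g) (label-pos cᵢ⊑c (lab∈labs cᵢ))))
          (annotated⇒HL+-branch gcs mem n (Unique-branch gcs u-gcs mem) cᵢ⊑c (inj₁ (labs⊆ d⊑c (here refl)))
            (Valid-embed (Embeds-DO k u mem) valid))
        where cᵢ⊑c = ⊑-trans (⊑-trans (branch-⊑-IF gcs mem) (IF-⊑-DO gcs)) d⊑c

    annotated⇒HL+-branch : ∀ gcs {e d} → (e , d) ∈ gcList gcs →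
                           ∀ k → Unique (labs d) → d ⊑ c → CtrlPt c f k → Valid d k an →
                           HL+ D d (an (lab d)) (an k)
    annotated⇒HL+-branch [ _ ⇒ d ]    (here refl) = annotated⇒HL+ d
    annotated⇒HL+-branch (_ ⇒ d ∷ _)  (here refl) = annotated⇒HL+ d
    annotated⇒HL+-branch (_ ⇒ _ ∷ gs) (there mem) = annotated⇒HL+-branch gs mem

theorem5p13 : (c : Cmd) (f : Label) (an : Label → Assn) (P Q : Assn) →
    WF c → Okf c f → (∀ i → Ext (an i)) →
    AnnotFor c f an P Q → Valid c f an →
    (pc : Var) → Fresh pc c f an →
    HL+ (Derived pc c f an) c P Q
theorem5p13 c f an P Q _ (labs-pos , u , _) _ (an-entry⇔P , an-exit⇔Q) valid pc _ =
  Conseq (D-resp-⇔ an-entry⇔P (D-entry ⊑-refl)) (D-resp-⇔ an-exit⇔Q (D-an (inj₂ refl)))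
    (λ s → Equivalence.from (an-entry⇔P s))
    (annotated⇒HL+ c f u ⊑-refl (inj₂ refl) valid)
    (λ s → Equivalence.to (an-exit⇔Q s))
  where open FromValidAnnotation c f an pc labs-pos
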